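{- Each of the following intervals $[\mathcal{D}_1,\mathcal{D}_2]=\{\mathcal{K}\in{\bf E}_{\mathbb{B}}:\mathcal{D}_1\subseteq\mathcal{K}\subseteq\mathcal{D}_2\}$ contains uncountably many equational classes: (i) $[M\cap\mathcal{C},M]$ for $\mathcal{C}\in\{\Lambda,V\}$; (ii) $[M\cap U_2,M_0]$ and $[M\cap W_2,M_1]$; (iii) $[M_c\cap\mathcal{C},M_c]$ for $\mathcal{C}\in\{U_2,W_2\}$; (iv) $[SM,\mathcal{C}]$ for $\mathcal{C}\in\{M_c\cap U_2,M_c\cap W_2\}$.
   Context: Boolean functions are maps $\{0,1\}^n\to\{0,1\}$, $n\ge1$. An equational class is a set of Boolean functions closed under $f\mapsto f(p_1,\dots,p_n)$ for projections $p_i$; ${\bf E}_{\mathbb{B}}$ is the set of them. $M$ = monotone functions (componentwise order); $M_0=\{f\in M:f(0,\dots,0)=0\}$, $M_1=\{f\in M: f(1,\dots,1)=1\}$, $M_c=M_0\cap M_1$. The dual of $f$ is $f^d({\bf a})=1-f(\bar{\bf a})$; $SM=\{f\in M:f^d=f\}$. $\Lambda$ = constants ${\bf 0},{\bf 1}$ and all conjunctions $x_{i_1}\wedge\cdots\wedge x_{i_k}$; $V$ = constants and all disjunctions $x_{i_1}\vee\cdots\vee x_{i_k}$. A set $B\subseteq\{0,1\}^n$ is $a$-separating if some coordinate $i$ has $b_i=a$ for all $b\in B$; $U_2$ (resp. $W_2$) is the class of functions $f$ such that every subset of $f^{ -1}(1)$ (resp. $f^{ -1}(0)$) of size at most $2$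 is $1$-separating (resp. $0$-separating). -}

module Defs where

open import Data.Nat using (ℕ; zero; suc)
open import Data.Bool using (Bool; true; false; not; _≤_)
open import Data.Fin using (Fin)
open import Data.Vec using (Vec; []; _∷_; lookup; tabulate; replicate; map)
open import Data.List using (List)
open import Data.Bool.ListAction using (all; any)
open import Data.Product using (Σ; _×_; _,_; ∃)
open import Data.Sum using (_⊎_)
open import Relation.Binary.PropositionalEquality using (_≡_)
open import Relation.Nullary using (¬_)

-- Boolean functions of arity n, represented canonically by their truth
-- table (a complete binary decision tree on x₁, x₂, …, xₙ).

BF : ℕ → Set
BF zero    = Bool
BF (suc n) = BF n × BF n

eval : ∀ {n} → BF n → Vec Bool n → Bool
eval {zero}  b        []           = b
eval {suc n} (f₀ , f₁) (false ∷ xs) = eval f₀ xs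
eval {suc n} (f₀ , f₁) (true  ∷ xs) = eval f₁ xs

table : ∀ {n} → (Vec Bool n → Bool) → BF n
table {zero}  g = g []
table {suc n} g = table (λ xs → g (false ∷ xs)) , table (λ xs → g (true ∷ xs))

minor : ∀ {n m} → BF n → (Fin n → Fin m) → BF m
minor f σ = table (λ x → eval f (tabulate (λ i → lookup x (σ i))))

-- Classes of Boolean functions.  Arity ranges over n ≥ 1, written suc n.
-- A class is a subset of the (countable) set of all Boolean functions,
-- given by its characteristic function.

Class : Set
Class = (n : ℕ) → BF (suc n) → Bool

IsEquationalClass : Class → Set
IsEquationalClass K =
  ∀ n m (f : BF (suc n)) (σ : Fin (suc n) → Fin (suc m)) →
  K n f ≡ true → K m (minor f σ) ≡ true

Prop' : Set₁
Prop' = (n : ℕ) → BF (suc n) → Set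

_∩_ : Prop' → Prop' → Prop'
(P ∩ Q) n f = P n f × Q n f

InInterval : Prop' → Prop' → Class → Set
InInterval D₁ D₂ K =
  IsEquationalClass K
  × (∀ n f → D₁ n f → K n f ≡ true)
  × (∀ n f → K n f ≡ true → D₂ n f)

_≐_ : Class → Class → Set
K ≐ L = ∀ n f → K n f ≡ L n f

Uncountable : (Class → Set) → Set
Uncountable S = ¬ (Σ (ℕ → Class) λ e → ∀ K → S K → Σ ℕ λ i → K ≐ e i)

Monotone : Prop'
Monotone n f = ∀ (a b : Vec Bool (suc n)) →
  (∀ i → lookup a i ≤ lookup b i) → eval f a ≤ eval f b

M : Prop'
M = Monotone

M₀ : Prop'
M₀ n f = Monotone n f × eval f (replicate _ false) ≡ false

M₁ : Prop'
M₁ n f = Monotone n f × eval f (replicate _ true) ≡ true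

Mc : Prop'
Mc = M₀ ∩ M₁

SM : Prop'
SM n f = Monotone n f × (∀ a → eval f a ≡ not (eval f (map not a)))

Λ : Prop'
Λ n f = (∀ a → eval f a ≡ false) ⊎ (∀ a → eval f a ≡ true)
      ⊎ Σ (List (Fin (suc n))) λ is → ∀ a → eval f a ≡ all (lookup a) is

V : Prop'
V n f = (∀ a → eval f a ≡ false) ⊎ (∀ a → eval f a ≡ true)
      ⊎ Σ (List (Fin (suc n))) λ is → ∀ a → eval f a ≡ any (lookup a) is

-- Every subset of f⁻¹(1) of size ≤ 2 is 1-separating.  Subsets of size
-- ≤ 2 are {a,b} (a = b allowed, giving singletons); the empty set is
-- trivially separating since the arity is ≥ 1.
U₂ : Prop'
U₂ n f = ∀ a b → eval f a ≡ true → eval f b ≡ true →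
  ∃ λ i → lookup a i ≡ true × lookup b i ≡ true

W₂ : Prop'
W₂ n f = ∀ a b → eval f a ≡ false → eval f b ≡ false →
  ∃ λ i → lookup a i ≡ false × lookup b i ≡ false

-- Let amoₖ be the k-ary monotone function that is 1 iff at most one argument
-- is 0.  Say f has a pattern of type i if some map σ from the variables of f
-- into 4 + i "blocks" makes f ∘ σ agree with amo₄₊ᵢ on all vectors with one
-- or two zero blocks.  Patterns pull back along minors, amo₄₊ⱼ has a pattern
-- of type j and of no other type, and the functions in the lower ends of the
-- intervals have no patterns at all (two points with disjoint zero sets
-- exist in every pattern, which W₂ forbids).  Hence for every S ⊆ ℕ the
-- functions of the upper end that have no pattern of a type outside S form
-- an equational class of the interval containing amo₄₊ⱼ exactly for j ∈ S,
-- and a diagonal argument over S shows that no sequence enumerates these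
-- classes.  The remaining intervals are images of these under duality.
module Submission where

open import Defs
open import Data.Bool using (Bool; true; false; not; _∧_; b≤b; f≤t) renaming (_≤_ to _≤ᵇ_)
import Data.Bool.Properties as Boolₚ
open import Data.Bool.ListAction using (all; any)
open import Data.Empty using (⊥-elim)
open import Data.Fin using (Fin; zero; suc; punchIn)
open import Data.Fin.Patterns using (0F; 1F; 2F; 3F)
open import Data.Fin.Properties
  using (_≟_; any?; all?; ¬∀⟶∃¬; injective⇒≤; punchInᵢ≢i; punchIn-injective)
open import Data.List using (List; []; _∷_)
open import Data.Nat using (ℕ; zero; suc; _+_; _≤_; _<_)
open import Data.Nat.Properties using (≤-trans; ≤-pred; n≤1+n; ≤-antisym; +-cancelˡ-≡; allUpTo?)
open import Data.Product using (Σ; ∃; _×_; _,_; proj₁; proj₂)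
open import Data.Sum using (_⊎_; inj₁; inj₂)
open import Data.Vec using (Vec; []; _∷_; lookup; tabulate; replicate; map)
open import Data.Vec.Properties
  using (lookup∘tabulate; tabulate∘lookup; tabulate-cong; tabulate-∘; tabulate-allFin; map-const
        ; lookup-replicate; lookup-map; map-replicate; map-∘; map-cong; map-id)
import Data.Vec.Functional as Vector
open import Function using (_∘_; _$_; id)
open import Relation.Binary.PropositionalEquality
  using (_≡_; _≢_; _≗_; refl; sym; trans; cong; cong₂; subst; subst₂; ≢-sym; module ≡-Reasoning)
open import Relation.Nullary using (¬_; Dec; yes; no; does; _×-dec_; _→-dec_; ¬?)
open import Relation.Nullary.Decidable using (map′; dec-true; dec-false)

open ≡-Reasoning

private
  variable
    n m k : ℕ
    A B : Set

true≢false : true ≢ false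
true≢false ()

does-true⇒ : (a? : Dec A) → does a? ≡ true → A
does-true⇒ (yes a) _ = a
does-true⇒ (no _) ()

∃-function? : ∀ m {P : (Fin m → Fin k) → Set} → (∀ {σ τ} → σ ≗ τ → P σ → P τ) →
  (∀ σ → Dec (P σ)) → Dec (∃ P)
∃-function? zero    P-resp P? = map′ (λ p → _ , p) (λ (_ , p) → P-resp (λ ()) p) (P? (λ ()))
∃-function? (suc m) P-resp P? =
  map′ (λ (v , τ , p) → v Vector.∷ τ , p)
       (λ (σ , p) → σ 0F , σ ∘ suc , P-resp (λ { zero → refl ; (suc i) → refl }) p)
       (any? λ v → ∃-function? m (λ τ≗τ′ → P-resp (λ { zero → refl ; (suc i) → τ≗τ′ i }))
                                 (λ τ → P? (v Vector.∷ τ)))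

∧-false : ∀ x {y} → x ∧ y ≡ false → x ≡ false ⊎ y ≡ false
∧-false false _ = inj₁ refl
∧-false true  e = inj₂ e

eval-table : (g : Vec Bool n → Bool) → eval (table g) ≗ g
eval-table {zero}  g []          = refl
eval-table {suc n} g (false ∷ x) = eval-table (g ∘ (false ∷_)) x
eval-table {suc n} g (true  ∷ x) = eval-table (g ∘ (true ∷_)) x

table-cong : {g h : Vec Bool n → Bool} → g ≗ h → table g ≡ table h
table-cong {zero}  g≗h = g≗h []
table-cong {suc n} g≗h =
  cong₂ _,_ (table-cong (g≗h ∘ (false ∷_))) (table-cong (g≗h ∘ (true ∷_)))

table-eval : (f : BF n) → table (eval f) ≡ f
table-eval {zero}  b         = refl
table-eval {suc n} (f₀ , f₁) = cong₂ _,_ (table-eval f₀) (table-eval f₁)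

reindex : (Fin m → Fin k) → Vec A k → Vec A m
reindex σ x = tabulate (lookup x ∘ σ)

lookup-reindex : (σ : Fin m → Fin k) (x : Vec A k) → lookup (reindex σ x) ≗ lookup x ∘ σ
lookup-reindex σ x = lookup∘tabulate (lookup x ∘ σ)

lookup-reindex-tabulate : (σ : Fin m → Fin k) (g : Fin k → A) →
  lookup (reindex σ (tabulate g)) ≗ g ∘ σ
lookup-reindex-tabulate σ g p = trans (lookup-reindex σ (tabulate g) p) (lookup∘tabulate g (σ p))

reindex-∘ : (σ : Fin k → Fin n) (τ : Fin m → Fin k) (x : Vec A n) →
  reindex τ (reindex σ x) ≡ reindex (σ ∘ τ) x
reindex-∘ σ τ x = tabulate-cong (lookup-reindex σ x ∘ τ)

reindex-cong : {σ τ : Fin m → Fin k} → σ ≗ τ → (x : Vec A k) → reindex σ x ≡ reindex τ x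
reindex-cong σ≗τ x = tabulate-cong (cong (lookup x) ∘ σ≗τ)

reindex-map : (σ : Fin m → Fin k) (g : A → B) (x : Vec A k) →
  reindex σ (map g x) ≡ map g (reindex σ x)
reindex-map σ g x = trans (tabulate-cong (λ p → lookup-map (σ p) g x)) (tabulate-∘ g (lookup x ∘ σ))

lookup-const⇒replicate : (x : Vec A n) {c : A} → (∀ p → lookup x p ≡ c) → x ≡ replicate n c
lookup-const⇒replicate x {c} h =
  trans (sym (tabulate∘lookup x)) (trans (tabulate-cong h) (trans (tabulate-allFin _) (map-const _ c)))

reindex-replicate : (σ : Fin m → Fin k) (c : A) → reindex σ (replicate k c) ≡ replicate m c
reindex-replicate σ c = lookup-const⇒replicate (reindex σ (replicate _ c)) (λ p →
  trans (lookup-reindex σ (replicate _ c) p) (lookup-replicate (σ p) c))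

eval-minor : (f : BF n) (σ : Fin n → Fin m) → eval (minor f σ) ≗ eval f ∘ reindex σ
eval-minor f σ = eval-table (eval f ∘ reindex σ)

eval-minor-reindex : (f : BF n) (τ : Fin n → Fin m) (σ : Fin m → Fin k) (x : Vec Bool k) →
  eval (minor f τ) (reindex σ x) ≡ eval f (reindex (σ ∘ τ) x)
eval-minor-reindex f τ σ x = trans (eval-minor f τ (reindex σ x)) (cong (eval f) (reindex-∘ σ τ x))

infix 4 _≤ᵛ_

_≤ᵛ_ : Vec Bool n → Vec Bool n → Set
a ≤ᵛ b = ∀ i → lookup a i ≤ᵇ lookup b i

reindex-mono : (σ : Fin m → Fin k) {a b : Vec Bool k} → a ≤ᵛ b → reindex σ a ≤ᵛ reindex σ b
reindex-mono σ {a} {b} a≤b p =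
  subst₂ _≤ᵇ_ (sym (lookup-reindex σ a p)) (sym (lookup-reindex σ b p)) (a≤b (σ p))

not-antitone : ∀ {x y} → x ≤ᵇ y → not y ≤ᵇ not x
not-antitone b≤b          = b≤b
not-antitone f≤t = f≤t

map-not-antitone : {a b : Vec Bool n} → a ≤ᵛ b → map not b ≤ᵛ map not a
map-not-antitone {a = a} {b} a≤b i =
  subst₂ _≤ᵇ_ (sym (lookup-map i not b)) (sym (lookup-map i not a)) (not-antitone (a≤b i))

≤-false : ∀ {x} → x ≤ᵇ false → x ≡ false
≤-false x≤0 = Boolₚ.≤-antisym x≤0 (Boolₚ.≤-minimum _)

true≰false : ¬ (true ≤ᵇ false)
true≰false ()

_⊆_ : Prop' → Prop' → Set
P ⊆ Q = ∀ n f → P n f → Q n f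

MinorClosed : Prop' → Set
MinorClosed P = ∀ n m f (σ : Fin (suc n) → Fin (suc m)) → P n f → P m (minor f σ)

∩-minorClosed : {P Q : Prop'} → MinorClosed P → MinorClosed Q → MinorClosed (P ∩ Q)
∩-minorClosed P-closed Q-closed n m f σ (p , q) = P-closed n m f σ p , Q-closed n m f σ q

monotone-minorClosed : MinorClosed Monotone
monotone-minorClosed n m f σ f-mono a b a≤b =
  subst₂ _≤ᵇ_ (sym (eval-minor f σ a)) (sym (eval-minor f σ b))
    (f-mono (reindex σ a) (reindex σ b) (reindex-mono σ {a} {b} a≤b))

eval-minor-replicate : (f : BF n) (σ : Fin n → Fin m) (c : Bool) →
  eval (minor f σ) (replicate m c) ≡ eval f (replicate n c)
eval-minor-replicate f σ c = trans (eval-minor f σ _) (cong (eval f) (reindex-replicate σ c))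

M₀-minorClosed : MinorClosed M₀
M₀-minorClosed n m f σ (f-mono , f0) =
  monotone-minorClosed n m f σ f-mono , trans (eval-minor-replicate f σ false) f0

M₁-minorClosed : MinorClosed M₁
M₁-minorClosed n m f σ (f-mono , f1) =
  monotone-minorClosed n m f σ f-mono , trans (eval-minor-replicate f σ true) f1

Mc-minorClosed : MinorClosed Mc
Mc-minorClosed = ∩-minorClosed M₀-minorClosed M₁-minorClosed

U₂-minorClosed : MinorClosed U₂
U₂-minorClosed n m f σ u a b fa fb
  with u (reindex σ a) (reindex σ b) (trans (sym (eval-minor f σ a)) fa) (trans (sym (eval-minor f σ b)) fb)
... | i , ai , bi = σ i , trans (sym (lookup-reindex σ a i)) ai
                        , trans (sym (lookup-reindex σ b i)) bi

allVectors? : {P : Vec Bool n → Set} → (∀ v → Dec (P v)) → Dec (∀ v → P v)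
allVectors? {zero}  P? = map′ (λ { p [] → p }) (λ h → h []) (P? [])
allVectors? {suc n} P? =
  map′ (λ { (p₀ , p₁) (false ∷ v) → p₀ v ; (p₀ , p₁) (true ∷ v) → p₁ v })
       (λ h → (h ∘ (false ∷_)) , (h ∘ (true ∷_)))
       (allVectors? (P? ∘ (false ∷_)) ×-dec allVectors? (P? ∘ (true ∷_)))

monotone? : ∀ n f → Dec (Monotone n f)
monotone? n f = allVectors? λ a → allVectors? λ b →
  all? (λ i → lookup a i Boolₚ.≤? lookup b i) →-dec (eval f a Boolₚ.≤? eval f b)

M₀? : ∀ n f → Dec (M₀ n f)
M₀? n f = monotone? n f ×-dec (eval f (replicate _ false) Boolₚ.≟ false)

M₁? : ∀ n f → Dec (M₁ n f)
M₁? n f = monotone? n f ×-dec (eval f (replicate _ true) Boolₚ.≟ true)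

Mc? : ∀ n f → Dec (Mc n f)
Mc? n f = M₀? n f ×-dec M₁? n f

U₂? : ∀ n f → Dec (U₂ n f)
U₂? n f = allVectors? λ a → allVectors? λ b →
  (eval f a Boolₚ.≟ true) →-dec ((eval f b Boolₚ.≟ true) →-dec
    any? (λ i → (lookup a i Boolₚ.≟ true) ×-dec (lookup b i Boolₚ.≟ true)))

W₂⇒one : ∀ n f → W₂ n f → eval f (replicate _ true) ≡ true
W₂⇒one n f w with eval f (replicate _ true) in f1
... | true  = refl
... | false with w (replicate _ true) (replicate _ true) f1 f1
...   | i , 1≡0 , _ = ⊥-elim (true≢false (trans (sym (lookup-replicate i true)) 1≡0))

V⇒zero⊎W₂ : ∀ n f → V n f → (∀ a → eval f a ≡ false) ⊎ W₂ n f
V⇒zero⊎W₂ n f (inj₁ f≡0)               = inj₁ f≡0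
V⇒zero⊎W₂ n f (inj₂ (inj₁ one))         =
  inj₂ λ a _ fa _ → ⊥-elim (true≢false (trans (sym (one a)) fa))
V⇒zero⊎W₂ n f (inj₂ (inj₂ ([] , f≡)))    = inj₁ f≡
V⇒zero⊎W₂ n f (inj₂ (inj₂ (q ∷ _ , f≡))) = inj₂ λ a b fa fb →
  q , Boolₚ.∨-conicalˡ _ _ (trans (sym (f≡ a)) fa) , Boolₚ.∨-conicalˡ _ _ (trans (sym (f≡ b)) fb)

self-dual-bounds : ∀ {x y} → x ≡ not y → y ≤ᵇ x → x ≡ true × y ≡ false
self-dual-bounds {true}  {false} _  _ = refl , refl
self-dual-bounds {true}  {true}  () _
self-dual-bounds {false} {false} () _

SM⊆Mc : SM ⊆ Mc
SM⊆Mc n f (f-mono , f-sd) = (f-mono , proj₂ bounds) , (f-mono , proj₁ bounds)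
  where
  0≤1 : replicate _ false ≤ᵛ replicate _ true
  0≤1 i = subst₂ _≤ᵇ_ (sym (lookup-replicate i false)) (sym (lookup-replicate i true)) f≤t
  bounds : eval f (replicate _ true) ≡ true × eval f (replicate _ false) ≡ false
  bounds = self-dual-bounds
    (trans (f-sd (replicate _ true)) (cong (not ∘ eval f) (map-replicate not true _)))
    (f-mono (replicate _ false) (replicate _ true) 0≤1)

SM⊆U₂ : SM ⊆ U₂
SM⊆U₂ n f (f-mono , f-sd) a b fa fb
  with any? (λ i → (lookup a i Boolₚ.≟ true) ×-dec (lookup b i Boolₚ.≟ true))
... | yes common = common
... | no disjoint = ⊥-elim (true≰false (subst₂ _≤ᵇ_ fb f¬a (f-mono b (map not a) b≤¬a)))
  where
  f¬a : eval f (map not a) ≡ false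
  f¬a = Boolₚ.not-injective (trans (sym (f-sd a)) fa)
  b≤¬a : b ≤ᵛ map not a
  b≤¬a i rewrite lookup-map i not a with lookup a i in ai | lookup b i in bi
  ... | false | _     = Boolₚ.≤-maximum _
  ... | true  | false = b≤b
  ... | true  | true  = ⊥-elim (disjoint (i , ai , bi))

-- Duality

dual : BF n → BF n
dual f = table (λ a → not (eval f (map not a)))

eval-dual : (f : BF n) (a : Vec Bool n) → eval (dual f) a ≡ not (eval f (map not a))
eval-dual f = eval-table _

map-not-involutive : (a : Vec Bool n) → map not (map not a) ≡ a
map-not-involutive a = trans (sym (map-∘ not not a)) (trans (map-cong Boolₚ.not-involutive a) (map-id a))

dual-involutive : (f : BF n) → dual (dual f) ≡ f
dual-involutive f = trans (table-cong λ a → begin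
    not (eval (dual f) (map not a))          ≡⟨ cong not (eval-dual f (map not a)) ⟩
    not (not (eval f (map not (map not a)))) ≡⟨ Boolₚ.not-involutive _ ⟩
    eval f (map not (map not a))             ≡⟨ cong (eval f) (map-not-involutive a) ⟩
    eval f a                                 ∎)
  (table-eval f)

minor-dual : (f : BF n) (σ : Fin n → Fin m) → minor (dual f) σ ≡ dual (minor f σ)
minor-dual f σ = table-cong λ x → begin
  eval (dual f) (reindex σ x)          ≡⟨ eval-dual f _ ⟩
  not (eval f (map not (reindex σ x))) ≡⟨ cong (not ∘ eval f) (sym (reindex-map σ not x)) ⟩
  not (eval f (reindex σ (map not x))) ≡⟨ cong not (sym (eval-minor f σ (map not x))) ⟩
  not (eval (minor f σ) (map not x))   ∎

SM⇒dual-fixed : ∀ n f → SM n f → dual f ≡ f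
SM⇒dual-fixed n f (_ , f-sd) = trans (table-cong (sym ∘ f-sd)) (table-eval f)

_ᵈ : Prop' → Prop'
(P ᵈ) n f = P n (dual f)

∩-dual : {P P′ Q Q′ : Prop'} → P ⊆ (P′ ᵈ) → Q ⊆ (Q′ ᵈ) → (P ∩ Q) ⊆ ((P′ ∩ Q′) ᵈ)
∩-dual P⊆ Q⊆ n f (p , q) = P⊆ n f p , Q⊆ n f q

monotone-dual : Monotone ⊆ (Monotone ᵈ)
monotone-dual n f f-mono a b a≤b = subst₂ _≤ᵇ_ (sym (eval-dual f a)) (sym (eval-dual f b))
  (not-antitone (f-mono (map not b) (map not a) (map-not-antitone {a = a} {b} a≤b)))

eval-dual-replicate : (f : BF n) (c : Bool) → eval (dual f) (replicate n c) ≡ not (eval f (replicate n (not c)))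
eval-dual-replicate f c = trans (eval-dual f _) (cong (not ∘ eval f) (map-replicate not c _))

M₀-dual : M₀ ⊆ (M₁ ᵈ)
M₀-dual n f (f-mono , f0) = monotone-dual n f f-mono , trans (eval-dual-replicate f true) (cong not f0)

M₁-dual : M₁ ⊆ (M₀ ᵈ)
M₁-dual n f (f-mono , f1) = monotone-dual n f f-mono , trans (eval-dual-replicate f false) (cong not f1)

Mc-dual : Mc ⊆ (Mc ᵈ)
Mc-dual n f (f₀ , f₁) = M₁-dual n f f₁ , M₀-dual n f f₀

not≡⇒ : ∀ {x y} → not x ≡ y → x ≡ not y
not≡⇒ {x} e = trans (sym (Boolₚ.not-involutive x)) (cong not e)

U₂-dual : U₂ ⊆ (W₂ ᵈ)
U₂-dual n f u a b fa fb
  with u (map not a) (map not b) (not≡⇒ (trans (sym (eval-dual f a)) fa))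
                                 (not≡⇒ (trans (sym (eval-dual f b)) fb))
... | i , ai , bi = i , not≡⇒ (trans (sym (lookup-map i not a)) ai)
                      , not≡⇒ (trans (sym (lookup-map i not b)) bi)

SM-dual : SM ⊆ (SM ᵈ)
SM-dual n f sm = subst (SM n) (sym (SM⇒dual-fixed n f sm)) sm

SM⊆W₂ : SM ⊆ W₂
SM⊆W₂ n f sm = subst (W₂ n) (SM⇒dual-fixed n f sm) (U₂-dual n f (SM⊆U₂ n f sm))

not-all-map-not : (a : Vec Bool n) (is : List (Fin n)) → not (all (lookup (map not a)) is) ≡ any (lookup a) is
not-all-map-not a []       = refl
not-all-map-not a (i ∷ is) rewrite lookup-map i not a with lookup a i
... | true  = refl
... | false = not-all-map-not a is

Λ-dual : Λ ⊆ (V ᵈ)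
Λ-dual n f (inj₁ f≡0)             = inj₂ (inj₁ λ a → trans (eval-dual f a) (cong not (f≡0 (map not a))))
Λ-dual n f (inj₂ (inj₁ one))      = inj₁ λ a → trans (eval-dual f a) (cong not (one (map not a)))
Λ-dual n f (inj₂ (inj₂ (is , f≡))) = inj₂ (inj₂ (is , λ a →
  trans (eval-dual f a) (trans (cong not (f≡ (map not a))) (not-all-map-not a is))))

dualClass : Class → Class
dualClass K n f = K n (dual f)

dualClass-interval : {D₁ D₂ D₁' D₂' : Prop'} {K : Class} → D₁' ⊆ (D₁ ᵈ) → D₂ ⊆ (D₂' ᵈ) →
  InInterval D₁ D₂ K → InInterval D₁' D₂' (dualClass K)
dualClass-interval {D₂' = D₂'} {K} D₁'⊆ D₂⊆ (K-closed , D₁⊆K , K⊆D₂) =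
    (λ n m f σ Kf → subst (λ g → K m g ≡ true) (minor-dual f σ) (K-closed n m (dual f) σ Kf))
  , (λ n f d → D₁⊆K n (dual f) (D₁'⊆ n f d))
  , (λ n f Kf → subst (D₂' n) (dual-involutive f) (D₂⊆ n (dual f) (K⊆D₂ n (dual f) Kf)))

uncountable-dual : {D₁ D₂ D₁' D₂' : Prop'} → D₁' ⊆ (D₁ ᵈ) → D₂ ⊆ (D₂' ᵈ) →
  Uncountable (InInterval D₁ D₂) → Uncountable (InInterval D₁' D₂')
uncountable-dual {D₁} {D₂} D₁'⊆ D₂⊆ uncountable (e , enumerates) =
  uncountable (dualClass ∘ e , enumeratesᵈ)
  where
  enumeratesᵈ : ∀ K → InInterval D₁ D₂ K → Σ ℕ λ i → K ≐ dualClass (e i)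
  enumeratesᵈ K K∈ with enumerates (dualClass K) (dualClass-interval D₁'⊆ D₂⊆ K∈)
  ... | i , Kᵈ≐eᵢ = i , λ n f → trans (cong (K n) (sym (dual-involutive f))) (Kᵈ≐eᵢ n (dual f))

-- The function "at most one argument is 0"

AtMostOneFalse : Vec Bool n → Set
AtMostOneFalse v = ∀ p q → lookup v p ≡ false → lookup v q ≡ false → p ≡ q

atMostOneFalse? : (v : Vec Bool n) → Dec (AtMostOneFalse v)
atMostOneFalse? v = all? λ p → all? λ q →
  (lookup v p Boolₚ.≟ false) →-dec ((lookup v q Boolₚ.≟ false) →-dec (p ≟ q))

-- Abstract, so that type checking never unfolds a truth table of unknown size.
abstract
  amo : ∀ n → BF n
  amo n = table (does ∘ atMostOneFalse?)

  amo-true⇒ : (v : Vec Bool n) → eval (amo n) v ≡ true → AtMostOneFalse v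
  amo-true⇒ v e = does-true⇒ (atMostOneFalse? v) (trans (sym (eval-table _ v)) e)

  amo-true⇐ : (v : Vec Bool n) → AtMostOneFalse v → eval (amo n) v ≡ true
  amo-true⇐ v h = trans (eval-table _ v) (dec-true (atMostOneFalse? v) h)

  amo-false⇐ : (v : Vec Bool n) → ¬ AtMostOneFalse v → eval (amo n) v ≡ false
  amo-false⇐ v h = trans (eval-table _ v) (dec-false (atMostOneFalse? v) h)

atMostOneFalse-true : (v : Vec Bool n) → AtMostOneFalse v →
  ∀ {p q} → lookup v p ≡ false → q ≢ p → lookup v q ≡ true
atMostOneFalse-true v u {p} {q} vp q≢p with lookup v q in vq
... | true  = refl
... | false = ⊥-elim (q≢p (u q p vq vp))

atMostOneFalse-one-of-two : (v : Vec Bool n) → AtMostOneFalse v → ∀ {p q} → p ≢ q →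
  lookup v p ≡ true ⊎ lookup v q ≡ true
atMostOneFalse-one-of-two v u {p} p≢q with lookup v p in vp
... | true  = inj₁ refl
... | false = inj₂ (atMostOneFalse-true v u vp (≢-sym p≢q))

amo-monotone : ∀ n → Monotone n (amo (suc n))
amo-monotone n a b a≤b with eval (amo (suc n)) a in fa
... | false = Boolₚ.≤-minimum _
... | true  = Boolₚ.≤-reflexive (sym (amo-true⇐ b λ p q bp bq →
  amo-true⇒ a fa p q (≤-false (subst (_ ≤ᵇ_) bp (a≤b p))) (≤-false (subst (_ ≤ᵇ_) bq (a≤b q)))))

amo-ones : eval (amo n) (replicate n true) ≡ true
amo-ones {n} = amo-true⇐ (replicate n true) λ p _ 1≡0 _ →
  ⊥-elim (true≢false (trans (sym (lookup-replicate p true)) 1≡0))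

amo-zeros : eval (amo (2 + n)) (replicate _ false) ≡ false
amo-zeros {n} = amo-false⇐ (replicate (2 + n) false) λ u → 0≢1 (u 0F 1F refl refl)
  where
  0≢1 : 0F ≢ 1F
  0≢1 ()

atMostOneFalse-common-one : (x y : Vec Bool (3 + n)) → AtMostOneFalse x → lookup x 0F ≡ false →
  AtMostOneFalse y → ∃ λ i → lookup x i ≡ true × lookup y i ≡ true
atMostOneFalse-common-one x y ux x0 uy with atMostOneFalse-one-of-two y uy {1F} {2F} (λ ())
... | inj₁ y1 = 1F , atMostOneFalse-true x ux x0 (λ ()) , y1
... | inj₂ y2 = 2F , atMostOneFalse-true x ux x0 (λ ()) , y2

amo-U₂ : U₂ (2 + n) (amo (3 + n))
amo-U₂ a b fa fb with lookup a 0F in a0 | lookup b 0F in b0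
... | true  | true  = 0F , a0 , b0
... | false | _     = atMostOneFalse-common-one a b (amo-true⇒ a fa) a0 (amo-true⇒ b fb)
... | true  | false with atMostOneFalse-common-one b a (amo-true⇒ b fb) b0 (amo-true⇒ a fa)
...   | i , bi , ai = i , ai , bi

amo∈M₁ : ∀ j → M₁ (3 + j) (amo (4 + j))
amo∈M₁ j = amo-monotone (3 + j) , amo-ones {4 + j}

amo∈Mc : ∀ j → Mc (3 + j) (amo (4 + j))
amo∈Mc j = (amo-monotone (3 + j) , amo-zeros {2 + j}) , amo∈M₁ j

-- Patterns

infix 4 _≢ᵇ_

_≢ᵇ_ : Fin k → Fin k → Bool
q ≢ᵇ l = not (does (q ≟ l))

≢ᵇ-false⇒ : {q l : Fin k} → (q ≢ᵇ l) ≡ false → q ≡ l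
≢ᵇ-false⇒ {q = q} {l} e with q ≟ l | e
... | yes q≡l | _ = q≡l
... | no _    | ()

≢ᵇ-true : {q l : Fin k} → q ≢ l → (q ≢ᵇ l) ≡ true
≢ᵇ-true {q = q} {l} q≢l with q ≟ l
... | yes q≡l = ⊥-elim (q≢l q≡l)
... | no _    = refl

≢ᵇ-refl : (l : Fin k) → (l ≢ᵇ l) ≡ false
≢ᵇ-refl l = cong not (dec-true (l ≟ l) refl)

zeroAt : Fin k → Vec Bool k
zeroAt l = tabulate (_≢ᵇ l)

zerosAt : Fin k → Fin k → Vec Bool k
zerosAt a b = tabulate (λ q → (q ≢ᵇ a) ∧ (q ≢ᵇ b))

lookup-zeroAt : (σ : Fin m → Fin k) (l : Fin k) (p : Fin m) → lookup (reindex σ (zeroAt l)) p ≡ (σ p ≢ᵇ l)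
lookup-zeroAt σ l = lookup-reindex-tabulate σ (_≢ᵇ l)

lookup-zerosAt : (σ : Fin m → Fin k) (a b : Fin k) (p : Fin m) →
  lookup (reindex σ (zerosAt a b)) p ≡ (σ p ≢ᵇ a) ∧ (σ p ≢ᵇ b)
lookup-zerosAt σ a b = lookup-reindex-tabulate σ _

-- F ∘ reindex σ agrees with amo on the vectors with exactly one or two zeros.
record Pattern (F : Vec Bool m → Bool) (σ : Fin m → Fin k) : Set where
  constructor mkPattern
  field
    ones : ∀ l → F (reindex σ (zeroAt l)) ≡ true
    twos : ∀ a b → a ≢ b → F (reindex σ (zerosAt a b)) ≡ false

pattern? : (F : Vec Bool m → Bool) (σ : Fin m → Fin k) → Dec (Pattern F σ)
pattern? F σ = map′ (λ (o , t) → mkPattern o t) (λ (mkPattern o t) → o , t) $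
  all? (λ l → F (reindex σ (zeroAt l)) Boolₚ.≟ true)
  ×-dec all? (λ a → all? λ b → ¬? (a ≟ b) →-dec (F (reindex σ (zerosAt a b)) Boolₚ.≟ false))

pattern-cong : {F : Vec Bool m → Bool} {σ τ : Fin m → Fin k} → σ ≗ τ → Pattern F σ → Pattern F τ
pattern-cong {F = F} σ≗τ (mkPattern ones twos) = mkPattern
  (λ l → trans (cong F (sym (reindex-cong σ≗τ (zeroAt l)))) (ones l))
  (λ a b a≢b → trans (cong F (sym (reindex-cong σ≗τ (zerosAt a b)))) (twos a b a≢b))

pattern-minor : (f : BF n) (τ : Fin n → Fin m) (σ : Fin m → Fin k) →
  Pattern (eval (minor f τ)) σ → Pattern (eval f) (σ ∘ τ)
pattern-minor f τ σ (mkPattern ones twos) = mkPattern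
  (λ l → trans (sym (eval-minor-reindex f τ σ (zeroAt l))) (ones l))
  (λ a b a≢b → trans (sym (eval-minor-reindex f τ σ (zerosAt a b))) (twos a b a≢b))

Hits : (Fin m → Fin k) → Fin k → Set
Hits σ b = ∃ λ p → σ p ≡ b

hits? : (σ : Fin m → Fin k) (b : Fin k) → Dec (Hits σ b)
hits? σ b = any? λ p → σ p ≟ b

surjective⇒≤ : (σ : Fin m → Fin k) → (∀ b → Hits σ b) → k ≤ m
surjective⇒≤ σ hits = injective⇒≤ {f = proj₁ ∘ hits} λ {b} {c} e →
  trans (sym (proj₂ (hits b))) (trans (cong σ e) (proj₂ (hits c)))

almostSurjective⇒≤ : (σ : Fin m → Fin (suc k)) (a : Fin (suc k)) → (∀ b → b ≢ a → Hits σ b) → k ≤ m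
almostSurjective⇒≤ σ a hits = injective⇒≤ {f = proj₁ ∘ hits′} λ {b} {c} e →
  punchIn-injective a b c (trans (sym (proj₂ (hits′ b))) (trans (cong σ e) (proj₂ (hits′ c))))
  where
  hits′ : ∀ b → Hits σ (punchIn a b)
  hits′ b = hits (punchIn a b) (punchInᵢ≢i a b)

-- If σ missed two blocks a and b, the pattern would take both values on the all-ones vector.
pattern-hits : {F : Vec Bool m → Bool} {σ : Fin m → Fin k} → Pattern F σ →
  ∀ {a b} → a ≢ b → ¬ Hits σ a → Hits σ b
pattern-hits {F = F} {σ} (mkPattern ones twos) {a} {b} a≢b miss-a with hits? σ b
... | yes hit-b  = hit-b
... | no  miss-b = ⊥-elim (true≢false (begin
  true                          ≡⟨ sym (ones a) ⟩
  F (reindex σ (zeroAt a))      ≡⟨ cong F (lookup-const⇒replicate _ λ p →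
                                     trans (lookup-zeroAt σ a p) (missed miss-a p)) ⟩
  F (replicate _ true)          ≡⟨ cong F (sym (lookup-const⇒replicate _ λ p →
                                     trans (lookup-zerosAt σ a b p) (cong₂ _∧_ (missed miss-a p) (missed miss-b p)))) ⟩
  F (reindex σ (zerosAt a b))   ≡⟨ twos a b a≢b ⟩
  false                         ∎))
  where
  missed : ∀ {c} → ¬ Hits σ c → ∀ p → (σ p ≢ᵇ c) ≡ true
  missed miss p = ≢ᵇ-true λ e → miss (p , e)

pattern-size : (σ : Fin m → Fin (suc k)) {F : Vec Bool m → Bool} → Pattern F σ → k ≤ m
pattern-size σ pat with all? (hits? σ)
... | yes hits-all = almostSurjective⇒≤ σ 0F (λ b _ → hits-all b)
... | no ¬hits-all with ¬∀⟶∃¬ _ (Hits σ) (hits? σ) ¬hits-all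
...   | a , miss-a = almostSurjective⇒≤ σ a (λ b b≢a → pattern-hits pat (≢-sym b≢a) miss-a)

zerosAt-disjoint : (q : Fin (4 + k)) → (q ≢ᵇ 0F) ∧ (q ≢ᵇ 1F) ≡ true ⊎ (q ≢ᵇ 2F) ∧ (q ≢ᵇ 3F) ≡ true
zerosAt-disjoint 0F            = inj₂ refl
zerosAt-disjoint 1F            = inj₂ refl
zerosAt-disjoint (suc (suc q)) = inj₁ refl

W₂-patternFree : ∀ {n f} → W₂ n f → (σ : Fin (suc n) → Fin (4 + k)) → ¬ Pattern (eval f) σ
W₂-patternFree w σ (mkPattern _ twos)
  with w (reindex σ (zerosAt 0F 1F)) (reindex σ (zerosAt 2F 3F)) (twos 0F 1F (λ ())) (twos 2F 3F (λ ()))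
... | p , x₀₁ , x₂₃ with zerosAt-disjoint (σ p)
...   | inj₁ t = true≢false (trans (sym t) (trans (sym (lookup-zerosAt σ 0F 1F p)) x₀₁))
...   | inj₂ t = true≢false (trans (sym t) (trans (sym (lookup-zerosAt σ 2F 3F p)) x₂₃))

V-patternFree : ∀ {n f} → V n f → (σ : Fin (suc n) → Fin (4 + k)) → ¬ Pattern (eval f) σ
V-patternFree {n = n} {f = f} v σ with V⇒zero⊎W₂ n f v
... | inj₁ f≡0 = λ (mkPattern ones _) → true≢false (trans (sym (ones 0F)) (f≡0 (reindex σ (zeroAt 0F))))
... | inj₂ w   = W₂-patternFree w σ

amo-pattern-id : Pattern (eval (amo k)) id
amo-pattern-id = mkPattern
    (λ l → amo-true⇐ _ λ p q zp zq → trans (at l p zp) (sym (at l q zq)))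
    (λ a b a≢b → amo-false⇐ _ λ u → a≢b (u a b
      (trans (lookup-zerosAt id a b a) (cong (_∧ (a ≢ᵇ b)) (≢ᵇ-refl a)))
      (trans (lookup-zerosAt id a b b) (trans (cong ((b ≢ᵇ a) ∧_) (≢ᵇ-refl b)) (Boolₚ.∧-zeroʳ _)))))
  where
  at : ∀ l p → lookup (reindex id (zeroAt l)) p ≡ false → p ≡ l
  at l p zp = ≢ᵇ-false⇒ (trans (sym (lookup-zeroAt id l p)) zp)

amo-pattern⇒injective : {σ : Fin m → Fin k} → Pattern (eval (amo m)) σ → ∀ {p q} → σ p ≡ σ q → p ≡ q
amo-pattern⇒injective {σ = σ} (mkPattern ones _) {p} {q} σp≡σq = amo-true⇒ _ (ones (σ p)) p q
  (trans (lookup-zeroAt σ (σ p) p) (≢ᵇ-refl (σ p)))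
  (trans (lookup-zeroAt σ (σ p) q) (trans (cong (_≢ᵇ σ p) (sym σp≡σq)) (≢ᵇ-refl (σ p))))

-- If a were missed, the zeros of reindex σ (zerosAt a b) would all come from the block b,
-- which σ hits at most once by injectivity.
amo-pattern⇒surjective : (σ : Fin m → Fin (2 + k)) → Pattern (eval (amo m)) σ → ∀ a → Hits σ a
amo-pattern⇒surjective {k = k} σ pat a with hits? σ a
... | yes hit  = hit
... | no  miss = ⊥-elim (true≢false (trans (sym (amo-true⇐ _ only-b-zeros)) (Pattern.twos pat a b a≢b)))
  where
  b : Fin (2 + k)
  b = punchIn a 0F
  a≢b : a ≢ b
  a≢b = ≢-sym (punchInᵢ≢i a 0F)
  zero⇒b : ∀ p → lookup (reindex σ (zerosAt a b)) p ≡ false → σ p ≡ b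
  zero⇒b p z with ∧-false (σ p ≢ᵇ a) (trans (sym (lookup-zerosAt σ a b p)) z)
  ... | inj₁ σp≡a = ⊥-elim (miss (p , ≢ᵇ-false⇒ σp≡a))
  ... | inj₂ σp≡b = ≢ᵇ-false⇒ σp≡b
  only-b-zeros : AtMostOneFalse (reindex σ (zerosAt a b))
  only-b-zeros p q zp zq = amo-pattern⇒injective pat (trans (zero⇒b p zp) (sym (zero⇒b q zq)))

amo-pattern-arity : (σ : Fin m → Fin (2 + k)) → Pattern (eval (amo m)) σ → m ≡ 2 + k
amo-pattern-arity σ pat =
  ≤-antisym (injective⇒≤ (amo-pattern⇒injective pat)) (surjective⇒≤ σ (amo-pattern⇒surjective σ pat))

-- Patterns of type i use 4 + i blocks, so that two disjoint pairs of blocks always exist.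
HasPattern : ℕ → (n : ℕ) → BF (suc n) → Set
HasPattern i n f = ∃ λ (σ : Fin (suc n) → Fin (4 + i)) → Pattern (eval f) σ

-- Abstract, so that type checking never unfolds the exhaustive search over all σ.
abstract
  hasPattern? : ∀ i n f → Dec (HasPattern i n f)
  hasPattern? i n f = ∃-function? (suc n) pattern-cong (pattern? (eval f))

hasPattern⇒< : ∀ {i n f} → HasPattern i n f → i < n
hasPattern⇒< {i} (σ , pat) = ≤-trans (n≤1+n (suc i)) (≤-pred (pattern-size σ pat))

hasPattern-minor : ∀ {i} n m f (σ : Fin (suc n) → Fin (suc m)) → HasPattern i m (minor f σ) → HasPattern i n f
hasPattern-minor n m f σ (τ , pat) = τ ∘ σ , pattern-minor f σ τ pat

amo-hasPattern : ∀ j → HasPattern j (3 + j) (amo (4 + j))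
amo-hasPattern j = id , amo-pattern-id

amo-hasPattern⇒≡ : ∀ {i} j → HasPattern i (3 + j) (amo (4 + j)) → i ≡ j
amo-hasPattern⇒≡ {i} j (σ , pat) = +-cancelˡ-≡ 4 i j (sym (amo-pattern-arity σ pat))

-- The diagonal argument

module Diagonal {D₁ D₂ : Prop'}
  (D₂? : ∀ n f → Dec (D₂ n f))
  (D₂-minorClosed : MinorClosed D₂)
  (amo∈D₂ : ∀ j → D₂ (3 + j) (amo (4 + j)))
  (D₁⊆D₂ : D₁ ⊆ D₂)
  (D₁-patternFree : ∀ n f → D₁ n f → ∀ {i} (σ : Fin (suc n) → Fin (4 + i)) → ¬ Pattern (eval f) σ)
  where

  Avoiding : (ℕ → Bool) → Prop'
  Avoiding S n f = ∀ i → S i ≡ false → ¬ HasPattern i n f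

  -- Only the types i < n can occur in an n-ary function, so the quantifier is bounded.
  avoiding? : ∀ S n f → Dec (Avoiding S n f)
  avoiding? S n f = map′ (λ h i Si pat → h (hasPattern⇒< pat) Si pat) (λ h {i} _ → h i)
    (allUpTo? (λ i → (S i Boolₚ.≟ false) →-dec ¬? (hasPattern? i n f)) n)

  classOf : (ℕ → Bool) → Class
  classOf S n f = does ((D₂? n f) ×-dec (avoiding? S n f))

  classOf-interval : ∀ S → InInterval D₁ D₂ (classOf S)
  classOf-interval S =
      (λ n m f σ Kf → let (d , av) = ∈classOf Kf in
        dec-true (D₂? m _ ×-dec avoiding? S m _)
          (D₂-minorClosed n m f σ d , λ i Si pat → av i Si (hasPattern-minor n m f σ pat)))
    , (λ n f d → dec-true (D₂? n f ×-dec avoiding? S n f)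
        (D₁⊆D₂ n f d , λ i _ (σ , pat) → D₁-patternFree n f d σ pat))
    , (λ n f Kf → proj₁ (∈classOf Kf))
    where
    ∈classOf : ∀ {n f} → classOf S n f ≡ true → D₂ n f × Avoiding S n f
    ∈classOf {n} {f} = does-true⇒ (D₂? n f ×-dec avoiding? S n f)

  classOf-amo : ∀ S j → classOf S (3 + j) (amo (4 + j)) ≡ S j
  classOf-amo S j = classOf-amo′ (S j) refl
    where
    amo-dec : Dec (D₂ (3 + j) (amo (4 + j)) × Avoiding S (3 + j) (amo (4 + j)))
    amo-dec = D₂? (3 + j) (amo (4 + j)) ×-dec avoiding? S (3 + j) (amo (4 + j))
    classOf-amo′ : ∀ b → S j ≡ b → classOf S (3 + j) (amo (4 + j)) ≡ b
    classOf-amo′ true  Sj = dec-true amo-dec (amo∈D₂ j , λ i Si pat →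
      true≢false (trans (sym Sj) (subst (λ i → S i ≡ false) (amo-hasPattern⇒≡ j pat) Si)))
    classOf-amo′ false Sj = dec-false amo-dec λ (_ , av) → av j Sj (amo-hasPattern j)

  diagonal : (ℕ → Class) → ℕ → Bool
  diagonal e j = not (e j (3 + j) (amo (4 + j)))

  uncountable : Uncountable (InInterval D₁ D₂)
  uncountable (e , enumerates) with enumerates (classOf (diagonal e)) (classOf-interval (diagonal e))
  ... | i , K≐eᵢ = Boolₚ.not-¬ refl (trans (sym (K≐eᵢ (3 + i) (amo (4 + i)))) (classOf-amo (diagonal e) i))

proposition7 : Uncountable (InInterval (M ∩ Λ) M)
    × Uncountable (InInterval (M ∩ V) M)
    × Uncountable (InInterval (M ∩ U₂) M₀)
    × Uncountable (InInterval (M ∩ W₂) M₁)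
    × Uncountable (InInterval (Mc ∩ U₂) Mc)
    × Uncountable (InInterval (Mc ∩ W₂) Mc)
    × Uncountable (InInterval SM (Mc ∩ U₂))
    × Uncountable (InInterval SM (Mc ∩ W₂))
proposition7 =
    uncountable-dual (∩-dual {P′ = M} {Q′ = V} monotone-dual Λ-dual) monotone-dual M∩V
  , M∩V
  , uncountable-dual (∩-dual {P′ = M} {Q′ = W₂} monotone-dual U₂-dual) M₁-dual M∩W₂
  , M∩W₂
  , uncountable-dual (∩-dual {P′ = Mc} {Q′ = W₂} Mc-dual U₂-dual) Mc-dual Mc∩W₂
  , Mc∩W₂
  , SM-Mc∩U₂
  , uncountable-dual SM-dual (∩-dual {P′ = Mc} {Q′ = W₂} Mc-dual U₂-dual) SM-Mc∩U₂
  where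
  M∩V : Uncountable (InInterval (M ∩ V) M)
  M∩V = Diagonal.uncountable monotone? monotone-minorClosed (λ j → amo-monotone (3 + j)) (λ _ _ → proj₁)
    (λ n f (_ , v) → V-patternFree v)
  M∩W₂ : Uncountable (InInterval (M ∩ W₂) M₁)
  M∩W₂ = Diagonal.uncountable M₁? M₁-minorClosed amo∈M₁ (λ n f (m , w) → m , W₂⇒one n f w)
    (λ n f (_ , w) → W₂-patternFree w)
  Mc∩W₂ : Uncountable (InInterval (Mc ∩ W₂) Mc)
  Mc∩W₂ = Diagonal.uncountable Mc? Mc-minorClosed amo∈Mc (λ _ _ → proj₁)
    (λ n f (_ , w) → W₂-patternFree w)
  SM-Mc∩U₂ : Uncountable (InInterval SM (Mc ∩ U₂))
  SM-Mc∩U₂ = Diagonal.uncountable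
    (λ n f → Mc? n f ×-dec U₂? n f) (∩-minorClosed Mc-minorClosed U₂-minorClosed)
    (λ j → amo∈Mc j , amo-U₂) (λ n f sm → SM⊆Mc n f sm , SM⊆U₂ n f sm)
    (λ n f sm → W₂-patternFree (SM⊆W₂ n f sm))
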